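{- For any nonempty symmetric set $S\subseteq\{0,1\}^n$, we have \[ \overline{\Lambda}_n(S)\ge n-r_n(S). \] Further, equality holds if and only if either $S$ or $\{0,1\}^n\setminus S$ is a peripheral interval.
   Context: For integers $a\le b$, $[a,b]$ denotes the integers between $a$ and $b$. The Hamming weight of $x\in\{0,1\}^n$ is $|x|=|\{i:x_i=1\}|$. A set $S\subseteq\{0,1\}^n$ is symmetric if it is closed under permutations of coordinates; $W_n(S)=\{|x|:x\in S\}$. For $i\in[0,n]$, $W_{n,i}=[0,i-1]\cup[n-i+1,n]$. For symmetric $S$, $\mu_n(S)=\max\{i\in[0,\lceil n/2\rceil]:W_{n,i}\subseteq W_n(S)\}$, $\Lambda_n(S)=|W_n(S)|-\mu_n(S)$, and $\overline{\Lambda}_n(S)=\Lambda_n(\{0,1\}^n\setminus S)$. For $x\in\{0,1\}^n$, $I\subseteq[n]$, $x_I=(x_i)_{i\in I}$. The index complexity is $r_n(S)=\min\{|I|:I\subseteq[n],\ \exists a\in S\text{ with } b_I\ne a_I\text{ for all } b\in S,\ b\neq a\}$. For $a\in[-1,n-1]$, $b\in[1,n+1]$, $a<b$, the peripheral interval $J_{n,a,b}$ is the symmetric set with $W_n(J_{n,a,b})=[0,a]\cup[b,n]$ (with $[0,-1]=[n+1,n]=\emptyset$). -}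

module Defs where

open import Data.Bool using (Bool; true; false; _∧_; _∨_; not; if_then_else_)
open import Data.Bool.Properties using () renaming (_≟_ to _≟ᴮ_)
open import Data.Nat using (ℕ; zero; suc; _+_; _∸_; _⊓_; _⊔_; _≤_; _<_; _≡ᵇ_; _<ᵇ_; _≤ᵇ_; ⌈_/2⌉)
open import Data.Integer as ℤ using (ℤ; +_; -[1+_])
open import Data.Fin using (Fin)
open import Data.Fin.Subset using (Subset; ∣_∣)
open import Data.Fin.Permutation using (Permutation′; _⟨$⟩ʳ_)
open import Data.List using (List; []; _∷_; [_]; map; _++_; foldr; upTo; allFin)
open import Data.Bool.ListAction using (any; all)
open import Data.Vec using (Vec; []; _∷_; lookup; tabulate)
open import Data.Vec.Properties using (≡-dec)
open import Data.Product using (∃; _×_)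
open import Data.Sum using (_⊎_)
open import Function.Bundles using (_⇔_)
open import Relation.Nullary using (does)
open import Relation.Binary.PropositionalEquality using (_≡_)

Bits : ℕ → Set
Bits n = Vec Bool n

BSet : ℕ → Set
BSet n = Bits n → Bool

compl : ∀ {n} → BSet n → BSet n
compl S x = not (S x)

Nonempty : ∀ {n} → BSet n → Set
Nonempty {n} S = ∃ λ (x : Bits n) → S x ≡ true

weight : ∀ {n} → Bits n → ℕ
weight [] = 0
weight (true ∷ x) = suc (weight x)
weight (false ∷ x) = weight x

permute : ∀ {n} → Permutation′ n → Bits n → Bits n
permute π x = tabulate (λ i → lookup x (π ⟨$⟩ʳ i))

Symmetric : ∀ {n} → BSet n → Set
Symmetric {n} S = ∀ (π : Permutation′ n) (x : Bits n) → S x ≡ true → S (permute π x) ≡ true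

allBits : (n : ℕ) → List (Bits n)
allBits zero = [ [] ]
allBits (suc n) = map (true ∷_) (allBits n) ++ map (false ∷_) (allBits n)

count : ∀ {A : Set} → (A → Bool) → List A → ℕ
count p [] = 0
count p (a ∷ as) = if p a then suc (count p as) else count p as

select : ∀ {A : Set} → (A → Bool) → List A → List A
select p [] = []
select p (a ∷ as) = if p a then a ∷ select p as else select p as

inW : ∀ {n} → BSet n → ℕ → Bool
inW {n} S w = any (λ x → S x ∧ (weight x ≡ᵇ w)) (allBits n)

-- |W_n(S)|  (W_n(S) ⊆ [0,n], and upTo (suc n) lists [0,n])
cardW : ∀ {n} → BSet n → ℕ
cardW {n} S = count (inW S) (upTo (suc n))

inWni : ℕ → ℕ → ℕ → Bool
inWni n i w = (w <ᵇ i) ∨ ((suc n ∸ i) ≤ᵇ w)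

-- W_{n,i} ⊆ W_n(S)   (both are subsets of [0,n])
WniSub : ∀ {n} → BSet n → ℕ → Bool
WniSub {n} S i = all (λ w → not (inWni n i w) ∨ inW S w) (upTo (suc n))

-- μ_n(S) = max { i ∈ [0,⌈n/2⌉] : W_{n,i} ⊆ W_n(S) }   (i = 0 always qualifies)
μ : ∀ {n} → BSet n → ℕ
μ {n} S = foldr _⊔_ 0 (select (WniSub S) (upTo (suc ⌈ n /2⌉)))

-- Λ_n(S) = |W_n(S)| - μ_n(S)   (μ_n(S) ≤ |W_n(S)| always, so ∸ is exact)
Λ : ∀ {n} → BSet n → ℕ
Λ S = cardW S ∸ μ S

Λbar : ∀ {n} → BSet n → ℕ
Λbar S = Λ (compl S)

allSubsets : (n : ℕ) → List (Subset n)
allSubsets = allBits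

differsOn : ∀ {n} → Subset n → Bits n → Bits n → Bool
differsOn {n} I a b = any (λ i → lookup I i ∧ not (does (lookup a i ≟ᴮ lookup b i))) (allFin n)

isolates : ∀ {n} → BSet n → Subset n → Bits n → Bool
isolates {n} S I a =
  S a ∧ all (λ b → not (S b) ∨ does (≡-dec _≟ᴮ_ b a) ∨ differsOn I a b) (allBits n)

admissible : ∀ {n} → BSet n → Subset n → Bool
admissible {n} S I = any (isolates S I) (allBits n)

-- r_n(S) = min { |I| : I admissible }.  (For nonempty S, I = [n] is admissible,
-- so the default value n of the fold is never the sole candidate.)
r : ∀ {n} → BSet n → ℕ
r {n} S = foldr _⊓_ n (map ∣_∣ (select (admissible S) (allSubsets n)))

IsPeripheralInterval : ∀ {n} → BSet n → Set
IsPeripheralInterval {n} S =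
  ∃ λ (a : ℤ) → ∃ λ (b : ℕ) →
    (-[1+ 0 ] ℤ.≤ a) × (a ℤ.≤ (+ n) ℤ.- (+ 1)) × (1 ≤ b) × (b ≤ suc n) × (a ℤ.< + b) ×
    (∀ (x : Bits n) → (S x ≡ true) ⇔ ((+ weight x ℤ.≤ a) ⊎ (b ≤ weight x)))

-- A symmetric S is determined by its weight set W_n(S); call the weights in [0, n]
-- outside it missing.  The points agreeing with a on an index set I have weights
-- filling an interval of ∣ ∁ I ∣ + 1 weights around |a|, and I isolates a exactly when
-- |a| is the only weight of S in that interval and a is empty or full outside I.
-- Hence n − r_n(S) is the length of the longest run of missing weights (every
-- maximal run borders a weight of S, as S ≠ ∅).  Such a run lies on one side of a
-- weight of S, so it misses one of the two end blocks of μ_n(∁S) missing weights, and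
-- counting both gives |W_n(∁S)| ≥ (n − r_n(S)) + μ_n(∁S).  Equality forces the
-- missing weights to be exactly this run and this block, which makes S or ∁S a
-- peripheral interval.  Conversely, the missing weights of a peripheral interval are
-- one run, or two end blocks of which the shorter lies within the μ-blocks and the
-- longer is a run bordering a weight of S.

module Submission where

open import Defs
open import Data.Nat using (ℕ; _∸_; _≤_)
open import Data.Sum using (_⊎_)
open import Data.Product using (_×_)
open import Function.Bundles using (_⇔_)
open import Relation.Binary.PropositionalEquality using (_≡_)

open import Data.Bool using (Bool; true; false; not; _∧_; _∨_; T)
open import Data.Bool.Properties using (⇔→≡; T-≡; T-∧; T-∨; not-involutive; ¬-not) renaming (_≟_ to _≟ᴮ_)
open import Data.Bool.ListAction using (or)
open import Data.Fin using (Fin; zero; suc)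
open import Data.Fin.Permutation using (transpose; lift₀)
open import Data.Fin.Subset using (Subset; ∣_∣; _∩_; ∁; ⊥)
open import Data.Fin.Subset.Properties using (∣∁p∣≡n∸∣p∣; ∣p∣≤n; ∣p∩q∣≤∣p∣)
open import Data.Integer using (-[1+_])
import Data.Integer as ℤ
import Data.Integer.Properties as ℤ
open import Data.List using (List; []; _∷_; map; _++_; foldr; upTo; applyUpTo)
open import Data.List.Properties using (map-tabulate)
open import Data.List.Membership.Propositional using (_∈_; find; lose)
open import Data.List.Membership.Propositional.Properties
  using (∈-map⁺; ∈-map⁻; ∈-++⁺ˡ; ∈-++⁺ʳ; ∈-upTo⁺; ∈-upTo⁻; foldr-selective)
open import Data.List.Relation.Unary.Any using (here; there)
open import Data.List.Relation.Unary.Any.Properties using (any⁺; any⁻)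
import Data.List.Relation.Unary.All as All
open import Data.List.Relation.Unary.All.Properties using (all⁺; all⁻)
open import Data.Nat using (suc; zero; _+_; _<_; _⊓_; _⊔_; _≟_; _<?_; z≤n; s≤s; z<s; ⌈_/2⌉)
open import Data.Nat.Properties
open import Data.Nat.Solver using (module +-*-Solver)
open +-*-Solver using (solve; _:+_; _:=_)
open import Data.Product using (∃; _,_; proj₁; proj₂; map₁)
open import Data.Sum using (inj₁; inj₂; [_,_]) renaming (map to ⊎-map)
open import Data.Sum.Function.Propositional using (_⊎-⇔_)
open import Data.Vec using ([]; _∷_; lookup)
open import Data.Vec.Properties using (tabulate∘lookup; ∷-injectiveˡ; ∷-injectiveʳ; ≡-dec)
open import Function using (_∘_; id)
open import Function.Bundles using (mk⇔; Equivalence)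
open import Relation.Binary.PropositionalEquality
  using (_≢_; refl; sym; trans; cong; cong₂; subst; subst₂; module ≡-Reasoning)
open import Relation.Nullary using (Dec; contradiction; does; yes; no)

∈-select⁺ : ∀ {A : Set} (P : A → Bool) {x xs} → x ∈ xs → P x ≡ true → x ∈ select P xs
∈-select⁺ P {xs = y ∷ ys} (here refl) Px rewrite Px = here refl
∈-select⁺ P {xs = y ∷ ys} (there x∈) Px with P y
... | true  = there (∈-select⁺ P x∈ Px)
... | false = ∈-select⁺ P x∈ Px

∈-select⁻ : ∀ {A : Set} (P : A → Bool) {x} xs → x ∈ select P xs → x ∈ xs × P x ≡ true
∈-select⁻ P (y ∷ ys) x∈ with P y in Py | x∈
... | true  | here refl = here refl , Py
... | true  | there x∈′ = map₁ there (∈-select⁻ P ys x∈′)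
... | false | x∈′       = map₁ there (∈-select⁻ P ys x∈′)

foldr-⊔-≥ : ∀ {d x xs} → x ∈ xs → x ≤ foldr _⊔_ d xs
foldr-⊔-≥ (here refl)             = m≤m⊔n _ _
foldr-⊔-≥ {xs = y ∷ _} (there x∈) = ≤-trans (foldr-⊔-≥ x∈) (m≤n⊔m y _)

foldr-⊓-≤ : ∀ {d x xs} → x ∈ xs → foldr _⊓_ d xs ≤ x
foldr-⊓-≤ (here refl)             = m⊓n≤m _ _
foldr-⊓-≤ {xs = y ∷ _} (there x∈) = ≤-trans (m⊓n≤n y _) (foldr-⊓-≤ x∈)

T-not-∨⇔ : ∀ {x y} → T (not x ∨ y) ⇔ (T x → y ≡ true)
T-not-∨⇔ {false} = mk⇔ (λ _ ()) _
T-not-∨⇔ {true}  = mk⇔ (λ y _ → Equivalence.to T-≡ y) (λ y → Equivalence.from T-≡ (y _))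

Constant : (ℕ → Bool) → Bool → ℕ → ℕ → Set
Constant H b lo hi = ∀ w → lo ≤ w → w < hi → H w ≡ b

Constant-⊆ : ∀ {H b lo hi lo′ hi′} → lo ≤ lo′ → hi′ ≤ hi →
             Constant H b lo hi → Constant H b lo′ hi′
Constant-⊆ lo≤lo′ hi′≤hi c w lo′≤w w<hi′ = c w (≤-trans lo≤lo′ lo′≤w) (≤-trans w<hi′ hi′≤hi)

interval : ℕ → ℕ → List ℕ
interval lo zero    = []
interval lo (suc k) = lo ∷ interval (suc lo) k

interval-+ : ∀ lo k l → interval lo (k + l) ≡ interval lo k ++ interval (lo + k) l
interval-+ lo zero    l = cong (λ x → interval x l) (sym (+-identityʳ lo))
interval-+ lo (suc k) l = cong (lo ∷_) (trans (interval-+ (suc lo) k l)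
                                              (cong (λ x → interval (suc lo) k ++ interval x l) (sym (+-suc lo k))))

countIn : (ℕ → Bool) → ℕ → ℕ → ℕ
countIn H lo hi = count H (interval lo (hi ∸ lo))

module _ (H : ℕ → Bool) where

  count-++ : ∀ xs ys → count H (xs ++ ys) ≡ count H xs + count H ys
  count-++ []       ys = refl
  count-++ (x ∷ xs) ys with H x
  ... | true  = cong suc (count-++ xs ys)
  ... | false = count-++ xs ys

  countIn-split : ∀ {lo mid hi} → lo ≤ mid → mid ≤ hi → countIn H lo hi ≡ countIn H lo mid + countIn H mid hi
  countIn-split {lo} {mid} {hi} lo≤mid mid≤hi = begin
    count H (interval lo (hi ∸ lo))
      ≡⟨ cong (λ k → count H (interval lo k)) (sym telescope) ⟩
    count H (interval lo ((mid ∸ lo) + (hi ∸ mid)))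
      ≡⟨ cong (count H) (interval-+ lo (mid ∸ lo) (hi ∸ mid)) ⟩
    count H (interval lo (mid ∸ lo) ++ interval (lo + (mid ∸ lo)) (hi ∸ mid))
      ≡⟨ count-++ (interval lo (mid ∸ lo)) _ ⟩
    countIn H lo mid + count H (interval (lo + (mid ∸ lo)) (hi ∸ mid))
      ≡⟨ cong (λ x → countIn H lo mid + count H (interval x (hi ∸ mid))) (m+[n∸m]≡n lo≤mid) ⟩
    countIn H lo mid + countIn H mid hi ∎
    where
    open ≡-Reasoning
    telescope : (mid ∸ lo) + (hi ∸ mid) ≡ hi ∸ lo
    telescope = +-cancelˡ-≡ lo _ _ (begin
      lo + ((mid ∸ lo) + (hi ∸ mid)) ≡⟨ sym (+-assoc lo _ _) ⟩
      lo + (mid ∸ lo) + (hi ∸ mid)   ≡⟨ cong (_+ (hi ∸ mid)) (m+[n∸m]≡n lo≤mid) ⟩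
      mid + (hi ∸ mid)               ≡⟨ m+[n∸m]≡n mid≤hi ⟩
      hi                             ≡⟨ sym (m+[n∸m]≡n (≤-trans lo≤mid mid≤hi)) ⟩
      lo + (hi ∸ lo)                 ∎)

  count-interval-≤ : ∀ lo k → count H (interval lo k) ≤ k
  count-interval-≤ lo zero    = z≤n
  count-interval-≤ lo (suc k) with H lo
  ... | true  = s≤s (count-interval-≤ (suc lo) k)
  ... | false = m≤n⇒m≤1+n (count-interval-≤ (suc lo) k)

  countIn-≤ : ∀ lo hi → countIn H lo hi ≤ hi ∸ lo
  countIn-≤ lo hi = count-interval-≤ lo (hi ∸ lo)

  count-interval-true : ∀ lo k → Constant H true lo (lo + k) → count H (interval lo k) ≡ k
  count-interval-true lo zero    _    = refl
  count-interval-true lo (suc k) run rewrite run lo ≤-refl (m<m+n lo z<s) =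
    cong suc (count-interval-true (suc lo) k λ w lo<w w<1+lo+k →
      run w (<⇒≤ lo<w) (subst (w <_) (sym (+-suc lo k)) w<1+lo+k))

  count-interval-false : ∀ lo k → Constant H false lo (lo + k) → count H (interval lo k) ≡ 0
  count-interval-false lo zero    _   = refl
  count-interval-false lo (suc k) gap rewrite gap lo ≤-refl (m<m+n lo z<s) =
    count-interval-false (suc lo) k λ w lo<w w<1+lo+k →
      gap w (<⇒≤ lo<w) (subst (w <_) (sym (+-suc lo k)) w<1+lo+k)

  count-interval≡0 : ∀ lo k → count H (interval lo k) ≡ 0 → Constant H false lo (lo + k)
  count-interval≡0 lo zero    _    w lo≤w w<lo+0 = contradiction lo≤w (<⇒≱ (subst (w <_) (+-identityʳ lo) w<lo+0))
  count-interval≡0 lo (suc k) none w lo≤w w<lo+1+k with H lo in Hlo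
  ... | false with m≤n⇒m<n∨m≡n lo≤w
  ...   | inj₂ refl = Hlo
  ...   | inj₁ lo<w = count-interval≡0 (suc lo) k none w lo<w (subst (w <_) (+-suc lo k) w<lo+1+k)

  countIn-true : ∀ {lo hi} → lo ≤ hi → Constant H true lo hi → countIn H lo hi ≡ hi ∸ lo
  countIn-true {lo} {hi} lo≤hi run =
    count-interval-true lo (hi ∸ lo) (subst (Constant H true lo) (sym (m+[n∸m]≡n lo≤hi)) run)

  countIn-false : ∀ {lo hi} → lo ≤ hi → Constant H false lo hi → countIn H lo hi ≡ 0
  countIn-false {lo} {hi} lo≤hi gap =
    count-interval-false lo (hi ∸ lo) (subst (Constant H false lo) (sym (m+[n∸m]≡n lo≤hi)) gap)

  countIn≡0 : ∀ {lo hi} → lo ≤ hi → countIn H lo hi ≡ 0 → Constant H false lo hi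
  countIn≡0 {lo} {hi} lo≤hi none =
    subst (Constant H false lo) (m+[n∸m]≡n lo≤hi) (count-interval≡0 lo (hi ∸ lo) none)

  countIn-run : ∀ {a k N} → a + k ≤ N → Constant H true a (a + k) → countIn H a N ≡ k + countIn H (a + k) N
  countIn-run {a} {k} a+k≤N run =
    trans (countIn-split (m≤m+n a k) a+k≤N)
          (cong (_+ countIn H (a + k) _) (trans (countIn-true (m≤m+n a k) run) (m+n∸m≡n a k)))

  two-runs : ∀ {a k c l N} → a + k ≤ c → c + l ≤ N →
             Constant H true a (a + k) → Constant H true c (c + l) →
             k + l ≤ countIn H 0 N ×
             (countIn H 0 N ≡ k + l →
              Constant H false 0 a × Constant H false (a + k) c × Constant H false (c + l) N)
  two-runs {a} {k} {c} {l} {N} a+k≤c c+l≤N run₁ run₂ =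
    subst (k + l ≤_) (sym total) (m≤m+n (k + l) _) , gaps
    where
    X = countIn H 0 a
    Y = countIn H (a + k) c
    Z = countIn H (c + l) N
    a≤c = ≤-trans (m≤m+n a k) a+k≤c
    c≤N = ≤-trans (m≤m+n c l) c+l≤N
    total : countIn H 0 N ≡ (k + l) + (X + Y + Z)
    total = begin
      countIn H 0 N
        ≡⟨ countIn-split z≤n (≤-trans a≤c c≤N) ⟩
      X + countIn H a N
        ≡⟨ cong (X +_) (trans (countIn-run (≤-trans a+k≤c c≤N) run₁)
                       (cong (k +_) (trans (countIn-split a+k≤c c≤N) (cong (Y +_) (countIn-run c+l≤N run₂))))) ⟩
      X + (k + (Y + (l + Z)))
        ≡⟨ solve 5 (λ X k Y l Z → X :+ (k :+ (Y :+ (l :+ Z))) := (k :+ l) :+ (X :+ Y :+ Z)) refl X k Y l Z ⟩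
      (k + l) + (X + Y + Z) ∎
      where open ≡-Reasoning
    gaps : countIn H 0 N ≡ k + l →
           Constant H false 0 a × Constant H false (a + k) c × Constant H false (c + l) N
    gaps eq = countIn≡0 z≤n (m+n≡0⇒m≡0 X X+Y≡0) , countIn≡0 a+k≤c (m+n≡0⇒n≡0 X X+Y≡0)
            , countIn≡0 c+l≤N (m+n≡0⇒n≡0 (X + Y) off≡0)
      where
      off≡0 : X + Y + Z ≡ 0
      off≡0 = +-cancelˡ-≡ (k + l) _ 0 (trans (sym total) (trans eq (sym (+-identityʳ (k + l)))))
      X+Y≡0 = m+n≡0⇒m≡0 (X + Y) off≡0

  countIn-split₃ : ∀ {lo hi N} → lo ≤ hi → hi ≤ N →
                   countIn H 0 N ≡ countIn H 0 lo + (countIn H lo hi + countIn H hi N)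
  countIn-split₃ {lo} lo≤hi hi≤N =
    trans (countIn-split z≤n (≤-trans lo≤hi hi≤N)) (cong (countIn H 0 lo +_) (countIn-split lo≤hi hi≤N))

  countIn-≤-hole : ∀ {lo hi N} → lo ≤ hi → hi ≤ N → Constant H false lo hi →
                   countIn H 0 N ≤ lo + (N ∸ hi)
  countIn-≤-hole {lo} {hi} {N} lo≤hi hi≤N hole =
    subst (_≤ lo + (N ∸ hi)) (sym (countIn-split₃ lo≤hi hi≤N))
      (+-mono-≤ (countIn-≤ 0 lo) (subst (_≤ N ∸ hi) (cong (_+ countIn H hi N) (sym (countIn-false lo≤hi hole)))
                                                    (countIn-≤ hi N)))

  countIn-≤-support : ∀ {lo hi N} → lo ≤ hi → hi ≤ N → Constant H false 0 lo → Constant H false hi N →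
                      countIn H 0 N ≤ hi ∸ lo
  countIn-≤-support {lo} {hi} {N} lo≤hi hi≤N below above =
    subst (_≤ hi ∸ lo) (sym (trans (countIn-split₃ lo≤hi hi≤N)
                                   (cong₂ (λ x y → x + (countIn H lo hi + y))
                                          (countIn-false z≤n below) (countIn-false hi≤N above))))
      (subst (_≤ hi ∸ lo) (sym (+-identityʳ _)) (countIn-≤ lo hi))

applyUpTo≡interval : ∀ {f} lo k → (∀ x → f x ≡ lo + x) → applyUpTo f k ≡ interval lo k
applyUpTo≡interval lo zero    _   = refl
applyUpTo≡interval lo (suc k) f≗ =
  cong₂ _∷_ (trans (f≗ 0) (+-identityʳ lo))
            (applyUpTo≡interval (suc lo) k λ x → trans (f≗ (suc x)) (+-suc lo x))

cardW≡countIn : ∀ {n} (U : BSet n) → cardW U ≡ countIn (inW U) 0 (suc n)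
cardW≡countIn {n} U = cong (count (inW U)) (applyUpTo≡interval 0 (suc n) λ _ → refl)

-- Symmetric sets and weights

-- The sorted point 1ᵏ0ⁿ⁻ᵏ, equally the set of the first k coordinates.
prefix : (n k : ℕ) → Subset n
prefix zero    _       = []
prefix (suc n) zero    = false ∷ prefix n zero
prefix (suc n) (suc k) = true ∷ prefix n k

weight≤n : ∀ {n} (x : Bits n) → weight x ≤ n
weight≤n []          = z≤n
weight≤n (true ∷ x)  = s≤s (weight≤n x)
weight≤n (false ∷ x) = m≤n⇒m≤1+n (weight≤n x)

weight-prefix : ∀ {n k} → k ≤ n → weight (prefix n k) ≡ k
weight-prefix {zero}  {zero}  _         = refl
weight-prefix {suc n} {zero}  _         = weight-prefix {n} z≤n
weight-prefix {suc n} {suc k} (s≤s k≤n) = cong suc (weight-prefix k≤n)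

WeightInvariant : ∀ {n} → BSet n → Set
WeightInvariant {n} S = ∀ (x y : Bits n) → weight x ≡ weight y → S x ≡ S y

Symmetric-tail : ∀ {n} (S : BSet (suc n)) → Symmetric S → ∀ c → Symmetric (λ x → S (c ∷ x))
Symmetric-tail S sym-S c π x = sym-S (lift₀ π) (c ∷ x)

Symmetric-swap : ∀ {n} (S : BSet (suc (suc n))) → Symmetric S →
                 ∀ a b (x : Bits n) → S (a ∷ b ∷ x) ≡ S (b ∷ a ∷ x)
Symmetric-swap S sym-S a b x = ⇔→≡ (mk⇔ (swap a b) (swap b a))
  where
  swap : ∀ a b → S (a ∷ b ∷ x) ≡ true → S (b ∷ a ∷ x) ≡ true
  swap a b Sx = subst (λ v → S (b ∷ a ∷ v) ≡ true) (tabulate∘lookup x)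
                      (sym-S (transpose zero (suc zero)) (a ∷ b ∷ x) Sx)

Symmetric-sink : ∀ {n k} (S : BSet (suc n)) → Symmetric S → k ≤ n →
                 S (false ∷ prefix n k) ≡ S (prefix (suc n) k)
Symmetric-sink {k = zero} S sym-S _ = refl
Symmetric-sink {suc n} {suc k} S sym-S (s≤s k≤n) =
  trans (Symmetric-swap S sym-S false true (prefix n k))
        (Symmetric-sink (λ x → S (true ∷ x)) (Symmetric-tail S sym-S true) k≤n)

Symmetric-sort : ∀ {n} (S : BSet n) → Symmetric S → (x : Bits n) → S x ≡ S (prefix n (weight x))
Symmetric-sort S sym-S []          = refl
Symmetric-sort S sym-S (true ∷ x)  =
  Symmetric-sort (λ x → S (true ∷ x)) (Symmetric-tail S sym-S true) x
Symmetric-sort S sym-S (false ∷ x) =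
  trans (Symmetric-sort (λ x → S (false ∷ x)) (Symmetric-tail S sym-S false) x)
        (Symmetric-sink S sym-S (weight≤n x))

Symmetric⇒WeightInvariant : ∀ {n} (S : BSet n) → Symmetric S → WeightInvariant S
Symmetric⇒WeightInvariant {n} S sym-S x y |x|≡|y| =
  trans (Symmetric-sort S sym-S x)
        (trans (cong (λ w → S (prefix n w)) |x|≡|y|) (sym (Symmetric-sort S sym-S y)))

WeightInvariant-compl : ∀ {n} (U : BSet n) → WeightInvariant U → WeightInvariant (compl U)
WeightInvariant-compl U inv x y |x|≡|y| = cong not (inv x y |x|≡|y|)

∈-allBits : ∀ {n} (x : Bits n) → x ∈ allBits n
∈-allBits []                  = here refl
∈-allBits {suc n} (true ∷ x)  = ∈-++⁺ˡ (∈-map⁺ (true ∷_) (∈-allBits x))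
∈-allBits {suc n} (false ∷ x) = ∈-++⁺ʳ (map (true ∷_) (allBits n)) (∈-map⁺ (false ∷_) (∈-allBits x))

inW-prefix : ∀ {n w} (S : BSet n) → WeightInvariant S → w ≤ n → inW S w ≡ S (prefix n w)
inW-prefix {n} {w} S inv w≤n = ⇔→≡ (mk⇔ to from)
  where
  |prefix|≡w = weight-prefix w≤n
  to : inW S w ≡ true → S (prefix n w) ≡ true
  to inW≡true with find (any⁻ _ (allBits n) (Equivalence.from T-≡ inW≡true))
  ... | x , _ , Sx∧|x|≡w with Equivalence.to (T-∧ {S x}) Sx∧|x|≡w
  ...   | Sx , |x|≡w =
    trans (inv (prefix n w) x (trans |prefix|≡w (sym (≡ᵇ⇒≡ _ _ |x|≡w)))) (Equivalence.to T-≡ Sx)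
  from : S (prefix n w) ≡ true → inW S w ≡ true
  from Sp = Equivalence.to T-≡ (any⁺ _ (lose (∈-allBits (prefix n w))
              (Equivalence.from (T-∧ {S (prefix n w)}) (Equivalence.from T-≡ Sp , ≡⇒≡ᵇ _ _ |prefix|≡w))))

module _ {n} (S : BSet n) (inv : WeightInvariant S) where

  inW-weight : ∀ x → S x ≡ inW S (weight x)
  inW-weight x = trans (inv x (prefix n (weight x)) (sym (weight-prefix (weight≤n x))))
                       (sym (inW-prefix S inv (weight≤n x)))

  inW-compl : ∀ {w} → w ≤ n → inW (compl S) w ≡ not (inW S w)
  inW-compl w≤n = trans (inW-prefix (compl S) (WeightInvariant-compl S inv) w≤n)
                        (cong not (sym (inW-prefix S inv w≤n)))

-- Cylinders over an index set

∁-involutive : ∀ {n} (p : Subset n) → ∁ (∁ p) ≡ p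
∁-involutive []      = refl
∁-involutive (x ∷ p) = cong₂ _∷_ (not-involutive x) (∁-involutive p)

∣∣≡weight : ∀ {n} (x : Subset n) → ∣ x ∣ ≡ weight x
∣∣≡weight []          = refl
∣∣≡weight (true ∷ x)  = cong suc (∣∣≡weight x)
∣∣≡weight (false ∷ x) = ∣∣≡weight x

∣prefix∣ : ∀ {n k} → k ≤ n → ∣ prefix n k ∣ ≡ k
∣prefix∣ {n} {k} k≤n = trans (∣∣≡weight (prefix n k)) (weight-prefix k≤n)

prefix-∩ : ∀ n k w → prefix n k ∩ prefix n w ≡ prefix n (k ⊓ w)
prefix-∩ zero    k       w       = refl
prefix-∩ (suc n) zero    zero    = cong (false ∷_) (prefix-∩ n zero zero)
prefix-∩ (suc n) zero    (suc w) = cong (false ∷_) (prefix-∩ n zero w)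
prefix-∩ (suc n) (suc k) zero    = cong (false ∷_) (trans (prefix-∩ n k zero) (cong (prefix n) (⊓-zeroʳ k)))
prefix-∩ (suc n) (suc k) (suc w) = cong (true ∷_) (prefix-∩ n k w)

∣I∣+∣∁I∣≡n : ∀ {n} (I : Subset n) → ∣ I ∣ + ∣ ∁ I ∣ ≡ n
∣I∣+∣∁I∣≡n I = trans (cong (∣ I ∣ +_) (∣∁p∣≡n∸∣p∣ I)) (m+[n∸m]≡n (∣p∣≤n I))

weight-split : ∀ {n} (I x : Subset n) → weight x ≡ ∣ I ∩ x ∣ + ∣ ∁ I ∩ x ∣
weight-split []          []          = refl
weight-split (true ∷ I)  (true ∷ x)  = cong suc (weight-split I x)
weight-split (true ∷ I)  (false ∷ x) = weight-split I x
weight-split (false ∷ I) (true ∷ x)  = trans (cong suc (weight-split I x)) (sym (+-suc _ _))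
weight-split (false ∷ I) (false ∷ x) = weight-split I x

∩-∁-injective : ∀ {n} (I : Subset n) {a b} → I ∩ a ≡ I ∩ b → ∁ I ∩ a ≡ ∁ I ∩ b → a ≡ b
∩-∁-injective []          {[]}    {[]}    _   _    = refl
∩-∁-injective (true ∷ I)  {p ∷ a} {q ∷ b} eq₁ eq₂ =
  cong₂ _∷_ (∷-injectiveˡ eq₁) (∩-∁-injective I (∷-injectiveʳ eq₁) (∷-injectiveʳ eq₂))
∩-∁-injective (false ∷ I) {p ∷ a} {q ∷ b} eq₁ eq₂ =
  cong₂ _∷_ (∷-injectiveˡ eq₂) (∩-∁-injective I (∷-injectiveʳ eq₁) (∷-injectiveʳ eq₂))

∣p∩x∣≡0⇒p∩x≡⊥ : ∀ {n} (p x : Subset n) → ∣ p ∩ x ∣ ≡ 0 → p ∩ x ≡ ⊥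
∣p∩x∣≡0⇒p∩x≡⊥ []          []          _ = refl
∣p∩x∣≡0⇒p∩x≡⊥ (true ∷ p)  (false ∷ x) e = cong (false ∷_) (∣p∩x∣≡0⇒p∩x≡⊥ p x e)
∣p∩x∣≡0⇒p∩x≡⊥ (false ∷ p) (_ ∷ x)     e = cong (false ∷_) (∣p∩x∣≡0⇒p∩x≡⊥ p x e)

∣p∩x∣≡∣p∣⇒p∩x≡p : ∀ {n} (p x : Subset n) → ∣ p ∩ x ∣ ≡ ∣ p ∣ → p ∩ x ≡ p
∣p∩x∣≡∣p∣⇒p∩x≡p []          []          _ = refl
∣p∩x∣≡∣p∣⇒p∩x≡p (true ∷ p)  (true ∷ x)  e =
  cong (true ∷_) (∣p∩x∣≡∣p∣⇒p∩x≡p p x (suc-injective e))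
∣p∩x∣≡∣p∣⇒p∩x≡p (true ∷ p)  (false ∷ x) e =
  contradiction (≤-reflexive (sym e)) (≤⇒≯ (∣p∩q∣≤∣p∣ p x))
∣p∩x∣≡∣p∣⇒p∩x≡p (false ∷ p) (_ ∷ x)     e = cong (false ∷_) (∣p∩x∣≡∣p∣⇒p∩x≡p p x e)

∩-extremal-unique : ∀ {n} (p : Subset n) {x y} → ∣ p ∩ x ∣ ≡ 0 ⊎ ∣ p ∩ x ∣ ≡ ∣ p ∣ →
                    ∣ p ∩ y ∣ ≡ ∣ p ∩ x ∣ → p ∩ y ≡ p ∩ x
∩-extremal-unique p {x} {y} (inj₁ e) eq =
  trans (∣p∩x∣≡0⇒p∩x≡⊥ p y (trans eq e)) (sym (∣p∩x∣≡0⇒p∩x≡⊥ p x e))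
∩-extremal-unique p {x} {y} (inj₂ e) eq =
  trans (∣p∩x∣≡∣p∣⇒p∩x≡p p y (trans eq e)) (sym (∣p∩x∣≡∣p∣⇒p∩x≡p p x e))

fill : ∀ {n} → Subset n → Bits n → ℕ → Bits n
fill []          []      t       = []
fill (true ∷ I)  (p ∷ a) t       = p ∷ fill I a t
fill (false ∷ I) (_ ∷ a) zero    = false ∷ fill I a zero
fill (false ∷ I) (_ ∷ a) (suc t) = true ∷ fill I a t

fill′ : ∀ {n} → Subset n → Bits n → ℕ → Bits n
fill′ []          []      t = []
fill′ (true ∷ I)  (p ∷ a) t = p ∷ fill′ I a t
fill′ (false ∷ I) (_ ∷ a) t = false ∷ fill I a t

∩-fill : ∀ {n} (I a : Subset n) t → I ∩ fill I a t ≡ I ∩ a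
∩-fill []          []      t       = refl
∩-fill (true ∷ I)  (p ∷ a) t       = cong (p ∷_) (∩-fill I a t)
∩-fill (false ∷ I) (_ ∷ a) zero    = cong (false ∷_) (∩-fill I a zero)
∩-fill (false ∷ I) (_ ∷ a) (suc t) = cong (false ∷_) (∩-fill I a t)

∩-fill′ : ∀ {n} (I a : Subset n) t → I ∩ fill′ I a t ≡ I ∩ a
∩-fill′ []          []      t = refl
∩-fill′ (true ∷ I)  (p ∷ a) t = cong (p ∷_) (∩-fill′ I a t)
∩-fill′ (false ∷ I) (_ ∷ a) t = cong (false ∷_) (∩-fill I a t)

∣∁∩fill∣ : ∀ {n} (I a : Subset n) {t} → t ≤ ∣ ∁ I ∣ → ∣ ∁ I ∩ fill I a t ∣ ≡ t
∣∁∩fill∣ []          []      z≤n       = refl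
∣∁∩fill∣ (true ∷ I)  (_ ∷ a) t≤        = ∣∁∩fill∣ I a t≤
∣∁∩fill∣ (false ∷ I) (_ ∷ a) z≤n       = ∣∁∩fill∣ I a z≤n
∣∁∩fill∣ (false ∷ I) (_ ∷ a) (s≤s t≤) = cong suc (∣∁∩fill∣ I a t≤)

∣∁∩fill′∣ : ∀ {n} (I a : Subset n) {t} → t < ∣ ∁ I ∣ → ∣ ∁ I ∩ fill′ I a t ∣ ≡ t
∣∁∩fill′∣ (true ∷ I)  (_ ∷ a) t<        = ∣∁∩fill′∣ I a t<
∣∁∩fill′∣ (false ∷ I) (_ ∷ a) (s≤s t≤) = ∣∁∩fill∣ I a t≤

fill≢fill′ : ∀ {n} (I a : Subset n) {t} → 0 < t → 0 < ∣ ∁ I ∣ → fill I a t ≢ fill′ I a t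
fill≢fill′ (true ∷ I)  (_ ∷ a) 0<t 0<∣∁I∣ = fill≢fill′ I a 0<t 0<∣∁I∣ ∘ ∷-injectiveʳ
fill≢fill′ (false ∷ I) (_ ∷ a) {suc t} _ _ = λ ()

-- Isolation and the index complexity

differsOn-∷ : ∀ {n} x (I : Subset n) p (a : Bits n) q (b : Bits n) →
              differsOn (x ∷ I) (p ∷ a) (q ∷ b) ≡ (x ∧ not (does (p ≟ᴮ q))) ∨ differsOn I a b
differsOn-∷ {n} x I p a q b =
  cong (_ ∨_) (trans (cong or (map-tabulate suc differ)) (sym (cong or (map-tabulate id (differ ∘ suc)))))
  where
  differ : Fin (suc n) → Bool
  differ i = lookup (x ∷ I) i ∧ not (does (lookup (p ∷ a) i ≟ᴮ lookup (q ∷ b) i))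

differsOn≡false⇔agree : ∀ {n} (I a b : Subset n) → differsOn I a b ≡ false ⇔ I ∩ a ≡ I ∩ b
differsOn≡false⇔agree []      []      []      = mk⇔ (λ _ → refl) (λ _ → refl)
differsOn≡false⇔agree (x ∷ I) (p ∷ a) (q ∷ b) rewrite differsOn-∷ x I p a q b with x | p ≟ᴮ q
... | false | _        = mk⇔ (cong (false ∷_) ∘ to) (from ∘ ∷-injectiveʳ)
  where open Equivalence (differsOn≡false⇔agree I a b)
... | true  | yes refl = mk⇔ (cong (p ∷_) ∘ to) (from ∘ ∷-injectiveʳ)
  where open Equivalence (differsOn≡false⇔agree I a b)
... | true  | no p≢q   = mk⇔ (λ ()) (λ eq → contradiction (∷-injectiveˡ eq) p≢q)

IsolatedBy : ∀ {n} → BSet n → Subset n → Bits n → Set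
IsolatedBy {n} S I a = S a ≡ true × (∀ b → S b ≡ true → I ∩ a ≡ I ∩ b → b ≡ a)

isolates⇔IsolatedBy : ∀ {n} (S : BSet n) I a → isolates S I a ≡ true ⇔ IsolatedBy S I a
isolates⇔IsolatedBy {n} S I a = mk⇔ to from
  where
  unique⇔ : ∀ b → T (not (S b) ∨ does (≡-dec _≟ᴮ_ b a) ∨ differsOn I a b) ⇔
                  (S b ≡ true → I ∩ a ≡ I ∩ b → b ≡ a)
  unique⇔ b with S b | ≡-dec _≟ᴮ_ b a | differsOn I a b in differs
  ... | false | _        | _     = mk⇔ (λ _ ()) _
  ... | true  | yes b≡a  | _     = mk⇔ (λ _ _ _ → b≡a) _
  ... | true  | no  _    | true  = mk⇔ (λ _ _ agree → contradiction
                                    (trans (sym differs) (Equivalence.from (differsOn≡false⇔agree I a b) agree)) λ ())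
                                   _
  ... | true  | no  b≢a  | false =
    mk⇔ (λ ()) (λ unique → b≢a (unique refl (Equivalence.to (differsOn≡false⇔agree I a b) differs)))
  to : isolates S I a ≡ true → IsolatedBy S I a
  to iso with Equivalence.to (T-∧ {S a}) (Equivalence.from T-≡ iso)
  ... | Sa , all-unique = Equivalence.to T-≡ Sa , λ b →
    Equivalence.to (unique⇔ b) (All.lookup (all⁺ _ (allBits n) all-unique) (∈-allBits b))
  from : IsolatedBy S I a → isolates S I a ≡ true
  from (Sa , unique) = Equivalence.to T-≡ (Equivalence.from (T-∧ {S a})
    (Equivalence.from T-≡ Sa ,
     all⁻ _ {xs = allBits n} (All.tabulate λ {b} _ → Equivalence.from (unique⇔ b) (unique b))))

module _ {n} (S : BSet n) where

  r≤∣I∣ : ∀ {I a} → IsolatedBy S I a → r S ≤ ∣ I ∣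
  r≤∣I∣ {I} {a} iso = foldr-⊓-≤ (∈-map⁺ ∣_∣ (∈-select⁺ (admissible S) (∈-allBits I) admissible-I))
    where
    admissible-I : admissible S I ≡ true
    admissible-I = Equivalence.to T-≡ (any⁺ _ (lose (∈-allBits a)
                     (Equivalence.from T-≡ (Equivalence.from (isolates⇔IsolatedBy S I a) iso))))

  r-attained : r S ≡ n ⊎ ∃ λ I → ∃ λ a → IsolatedBy S I a × ∣ I ∣ ≡ r S
  r-attained with foldr-selective ⊓-sel n (map ∣_∣ (select (admissible S) (allSubsets n)))
  ... | inj₁ r≡n = inj₁ r≡n
  ... | inj₂ r∈ with ∈-map⁻ ∣_∣ r∈
  ...   | I , I∈ , r≡∣I∣
    with find (any⁻ _ (allBits n) (Equivalence.from T-≡ (proj₂ (∈-select⁻ (admissible S) (allSubsets n) I∈))))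
  ...     | a , _ , iso =
    inj₂ (I , a , Equivalence.to (isolates⇔IsolatedBy S I a) (Equivalence.to T-≡ iso) , sym r≡∣I∣)

module _ {n} (S : BSet n) (inv : WeightInvariant S) where

  SingleWeight : Subset n → Bits n → Set
  SingleWeight I a = ∀ t → t ≤ ∣ ∁ I ∣ → inW S (∣ I ∩ a ∣ + t) ≡ true → t ≡ ∣ ∁ I ∩ a ∣

  Extremal : Subset n → Bits n → Set
  Extremal I a = ∣ ∁ I ∩ a ∣ ≡ 0 ⊎ ∣ ∁ I ∩ a ∣ ≡ ∣ ∁ I ∣

  -- The points agreeing with a on I realise exactly the weights ∣ I ∩ a ∣ + t, t ≤ ∣ ∁ I ∣,
  -- and a weight is realised by a single point only at the two extremes of t.
  IsolatedBy⇔ : ∀ I a → IsolatedBy S I a ⇔ (S a ≡ true × SingleWeight I a × Extremal I a)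
  IsolatedBy⇔ I a = mk⇔ to from
    where
    S-agreeing : ∀ {b} → I ∩ a ≡ I ∩ b → S b ≡ inW S (∣ I ∩ a ∣ + ∣ ∁ I ∩ b ∣)
    S-agreeing {b} agree =
      trans (inW-weight S inv b) (cong (inW S) (trans (weight-split I b) (cong (λ x → ∣ x ∣ + _) (sym agree))))
    to : IsolatedBy S I a → S a ≡ true × SingleWeight I a × Extremal I a
    to (Sa , unique) = Sa , single , extremal
      where
      single : SingleWeight I a
      single t t≤ F[j+t] = trans (sym (∣∁∩fill∣ I a t≤)) (cong (λ b → ∣ ∁ I ∩ b ∣) fill≡a)
        where
        agree = sym (∩-fill I a t)
        fill≡a = unique (fill I a t)
                   (trans (S-agreeing agree) (trans (cong (λ u → inW S (_ + u)) (∣∁∩fill∣ I a t≤)) F[j+t])) agree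
      same-weight : ∀ b → I ∩ a ≡ I ∩ b → ∣ ∁ I ∩ b ∣ ≡ ∣ ∁ I ∩ a ∣ → b ≡ a
      same-weight b agree eq = unique b (trans (inv b a |b|≡|a|) Sa) agree
        where
        |b|≡|a| = trans (weight-split I b) (trans (cong₂ _+_ (cong ∣_∣ (sym agree)) eq) (sym (weight-split I a)))
      extremal : Extremal I a
      extremal with ∣ ∁ I ∩ a ∣ ≟ 0 | m≤n⇒m<n∨m≡n (∣p∩q∣≤∣p∣ (∁ I) a)
      ... | yes t₀≡0 | _         = inj₁ t₀≡0
      ... | no  _    | inj₂ t₀≡m = inj₂ t₀≡m
      ... | no  t₀≢0 | inj₁ t₀<m =
        contradiction (trans (same-weight _ (sym (∩-fill I a _)) (∣∁∩fill∣ I a (<⇒≤ t₀<m)))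
                             (sym (same-weight _ (sym (∩-fill′ I a _)) (∣∁∩fill′∣ I a t₀<m))))
                      (fill≢fill′ I a (n≢0⇒n>0 t₀≢0) (≤-<-trans z≤n t₀<m))
    from : S a ≡ true × SingleWeight I a × Extremal I a → IsolatedBy S I a
    from (Sa , single , extremal) = Sa , λ b Sb agree →
      ∩-∁-injective I (sym agree) (∩-extremal-unique (∁ I) extremal
        (single _ (∣p∩q∣≤∣p∣ (∁ I) b) (trans (sym (S-agreeing agree)) Sb)))

  gap-of-isolated : ∀ {I a} → IsolatedBy S I a →
                    ∃ λ s → s + ∣ ∁ I ∣ ≤ suc n × Constant (inW S) false s (s + ∣ ∁ I ∣)
  gap-of-isolated {I} {a} iso with Equivalence.to (IsolatedBy⇔ I a) iso
  ... | _ , single , extremal = gap extremal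
    where
    j = ∣ I ∩ a ∣
    m = ∣ ∁ I ∣
    j+m≤n : j + m ≤ n
    j+m≤n = ≤-trans (+-monoˡ-≤ m (∣p∩q∣≤∣p∣ I a)) (≤-reflexive (∣I∣+∣∁I∣≡n I))
    absent : ∀ w → j ≤ w → w ≤ j + m → w ≢ j + ∣ ∁ I ∩ a ∣ → inW S w ≡ false
    absent w j≤w w≤j+m w≢ = ¬-not λ Fw → w≢ (trans (sym w≡j+t) (cong (j +_)
      (single (w ∸ j) (m≤n+o⇒m∸n≤o w j w≤j+m) (subst (λ u → inW S u ≡ true) (sym w≡j+t) Fw))))
      where w≡j+t = m+[n∸m]≡n j≤w
    gap : Extremal I a → ∃ λ s → s + m ≤ suc n × Constant (inW S) false s (s + m)
    gap (inj₁ t₀≡0) = suc j , s≤s j+m≤n , λ w j<w w<1+j+m →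
      absent w (<⇒≤ j<w) (≤-pred w<1+j+m) λ w≡ →
        <-irrefl (sym (trans w≡ (trans (cong (j +_) t₀≡0) (+-identityʳ j)))) j<w
    gap (inj₂ t₀≡m) = j , m≤n⇒m≤1+n j+m≤n , λ w j≤w w<j+m →
      absent w j≤w (<⇒≤ w<j+m) λ w≡ → <-irrefl (trans w≡ (cong (j +_) t₀≡m)) w<j+m

  gap-of-length-n∸r : ∃ λ s → s + (n ∸ r S) ≤ suc n × Constant (inW S) false s (s + (n ∸ r S))
  gap-of-length-n∸r with r-attained S
  ... | inj₁ r≡n rewrite r≡n | n∸n≡0 n = 0 , z≤n , λ _ _ ()
  ... | inj₂ (I , a , iso , ∣I∣≡r) =
    subst (λ m → ∃ λ s → s + m ≤ suc n × Constant (inW S) false s (s + m))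
          (trans (∣∁p∣≡n∸∣p∣ I) (cong (n ∸_) ∣I∣≡r)) (gap-of-isolated iso)

  private
    ≤n∸r : ∀ {m I a} → IsolatedBy S I a → ∣ I ∣ ≡ n ∸ m → m ≤ n → m ≤ n ∸ r S
    ≤n∸r {m} iso ∣I∣≡n∸m m≤n = m+n≤o⇒m≤o∸n m
      (≤-trans (+-monoʳ-≤ m (subst (r S ≤_) ∣I∣≡n∸m (r≤∣I∣ S iso))) (≤-reflexive (m+[n∸m]≡n m≤n)))

  gap-after-≤ : ∀ {w m} → inW S w ≡ true → w + m ≤ n →
                Constant (inW S) false (suc w) (suc (w + m)) → m ≤ n ∸ r S
  gap-after-≤ {w} {m} Fw w+m≤n gap =
    ≤n∸r (Equivalence.from (IsolatedBy⇔ I a) (Sa , single , inj₁ t₀≡0)) ∣I∣≡n∸m m≤n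
    where
    m≤n = ≤-trans (m≤n+m m w) w+m≤n
    w≤n∸m = m+n≤o⇒m≤o∸n w w+m≤n
    w≤n = ≤-trans (m≤m+n w m) w+m≤n
    I = prefix n (n ∸ m)
    a = prefix n w
    ∣I∣≡n∸m : ∣ I ∣ ≡ n ∸ m
    ∣I∣≡n∸m = ∣prefix∣ (m∸n≤m n m)
    ∣∁I∣≡m : ∣ ∁ I ∣ ≡ m
    ∣∁I∣≡m = trans (∣∁p∣≡n∸∣p∣ I) (trans (cong (n ∸_) ∣I∣≡n∸m) (m∸[m∸n]≡n m≤n))
    j≡w : ∣ I ∩ a ∣ ≡ w
    j≡w = trans (cong ∣_∣ (trans (prefix-∩ n (n ∸ m) w) (cong (prefix n) (m≥n⇒m⊓n≡n w≤n∸m))))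
                (∣prefix∣ w≤n)
    t₀≡0 : ∣ ∁ I ∩ a ∣ ≡ 0
    t₀≡0 = +-cancelˡ-≡ w _ 0 (trans (cong (_+ ∣ ∁ I ∩ a ∣) (sym j≡w))
             (trans (sym (weight-split I a)) (trans (weight-prefix w≤n) (sym (+-identityʳ w)))))
    Sa : S a ≡ true
    Sa = trans (inW-weight S inv a) (trans (cong (inW S) (weight-prefix w≤n)) Fw)
    single′ : ∀ t → t ≤ m → inW S (w + t) ≡ true → t ≡ 0
    single′ zero    _   _        = refl
    single′ (suc t) t≤m F[w+1+t] = contradiction (trans (sym F[w+1+t])
      (gap (w + suc t) (subst (suc w ≤_) (sym (+-suc w t)) (s≤s (m≤m+n w t))) (s≤s (+-monoʳ-≤ w t≤m)))) λ ()
    single : SingleWeight I a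
    single t t≤ F[j+t] =
      trans (single′ t (subst (t ≤_) ∣∁I∣≡m t≤) (subst (λ j → inW S (j + t) ≡ true) j≡w F[j+t])) (sym t₀≡0)

  gap-before-≤ : ∀ {s m} → inW S (s + m) ≡ true → s + m ≤ n →
                 Constant (inW S) false s (s + m) → m ≤ n ∸ r S
  gap-before-≤ {s} {m} Fs+m s+m≤n gap =
    ≤n∸r (Equivalence.from (IsolatedBy⇔ I a) (Sa , single , inj₂ (trans t₀≡m (sym ∣∁I∣≡m))))
         ∣I∣≡n∸m m≤n
    where
    m≤n = ≤-trans (m≤n+m m s) s+m≤n
    J = prefix n m
    I = ∁ J
    a = prefix n (s + m)
    ∁I≡J : ∁ I ≡ J
    ∁I≡J = ∁-involutive J
    ∣I∣≡n∸m : ∣ I ∣ ≡ n ∸ m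
    ∣I∣≡n∸m = trans (∣∁p∣≡n∸∣p∣ J) (cong (n ∸_) (∣prefix∣ m≤n))
    ∣∁I∣≡m : ∣ ∁ I ∣ ≡ m
    ∣∁I∣≡m = trans (cong ∣_∣ ∁I≡J) (∣prefix∣ m≤n)
    t₀≡m : ∣ ∁ I ∩ a ∣ ≡ m
    t₀≡m = trans (cong (λ X → ∣ X ∩ a ∣) ∁I≡J)
             (trans (cong ∣_∣ (trans (prefix-∩ n m (s + m)) (cong (prefix n) (m≤n⇒m⊓n≡m (m≤n+m m s)))))
                    (∣prefix∣ m≤n))
    j≡s : ∣ I ∩ a ∣ ≡ s
    j≡s = +-cancelʳ-≡ m _ s (trans (cong (∣ I ∩ a ∣ +_) (sym t₀≡m))
                                   (trans (sym (weight-split I a)) (weight-prefix s+m≤n)))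
    Sa : S a ≡ true
    Sa = trans (inW-weight S inv a) (trans (cong (inW S) (weight-prefix s+m≤n)) Fs+m)
    single′ : ∀ t → t ≤ m → inW S (s + t) ≡ true → t ≡ m
    single′ t t≤m F[s+t] with m≤n⇒m<n∨m≡n t≤m
    ... | inj₂ t≡m = t≡m
    ... | inj₁ t<m = contradiction (trans (sym F[s+t]) (gap (s + t) (m≤m+n s t) (+-monoʳ-< s t<m))) λ ()
    single : SingleWeight I a
    single t t≤ F[j+t] =
      trans (single′ t (subst (t ≤_) ∣∁I∣≡m t≤) (subst (λ j → inW S (j + t) ≡ true) j≡s F[j+t])) (sym t₀≡m)

-- End blocks

EndBlocks : ∀ {n} → BSet n → ℕ → Set
EndBlocks {n} U i = Constant (inW U) true 0 i × Constant (inW U) true (suc n ∸ i) (suc n)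

module _ {n} (U : BSet n) where

  WniSub⇔ : ∀ {i} → i ≤ suc n → WniSub U i ≡ true ⇔ EndBlocks U i
  WniSub⇔ {i} i≤1+n = mk⇔ to from
    where
    inWni⇔ : ∀ w → T (inWni n i w) ⇔ (w < i ⊎ suc n ∸ i ≤ w)
    inWni⇔ w = mk⇔ (λ h → ⊎-map (<ᵇ⇒< w i) (≤ᵇ⇒≤ (suc n ∸ i) w) (Equivalence.to T-∨ h))
                   (λ h → Equivalence.from T-∨ (⊎-map <⇒<ᵇ ≤⇒≤ᵇ h))
    covered : WniSub U i ≡ true → ∀ w → w ≤ n → w < i ⊎ suc n ∸ i ≤ w → inW U w ≡ true
    covered sub w w≤n w∈ = Equivalence.to T-not-∨⇔
      (All.lookup (all⁺ _ (upTo (suc n)) (Equivalence.from T-≡ sub)) (∈-upTo⁺ (s≤s w≤n)))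
      (Equivalence.from (inWni⇔ w) w∈)
    to : WniSub U i ≡ true → EndBlocks U i
    to sub = (λ w _ w<i → covered sub w (≤-pred (≤-trans w<i i≤1+n)) (inj₁ w<i))
           , (λ w le w<1+n → covered sub w (≤-pred w<1+n) (inj₂ le))
    from : EndBlocks U i → WniSub U i ≡ true
    from (prefix-block , suffix-block) = Equivalence.to T-≡ (all⁻ _ {xs = upTo (suc n)}
      (All.tabulate λ {w} w∈ → Equivalence.from T-not-∨⇔ λ h →
        [ prefix-block w z≤n , (λ le → suffix-block w le (∈-upTo⁻ w∈)) ] (Equivalence.to (inWni⇔ w) h)))

  μ-EndBlocks : EndBlocks U (μ U)
  μ-EndBlocks with foldr-selective ⊔-sel 0 (select (WniSub U) (upTo (suc ⌈ n /2⌉)))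
  ... | inj₁ μ≡0 = subst (EndBlocks U) (sym μ≡0)
                     ((λ _ _ ()) , λ w 1+n≤w w<1+n → contradiction w<1+n (≤⇒≯ 1+n≤w))
  ... | inj₂ μ∈ with ∈-select⁻ (WniSub U) _ μ∈
  ...   | μ∈upTo , sub =
    Equivalence.to (WniSub⇔ (≤-trans (≤-pred (∈-upTo⁻ μ∈upTo)) (≤-trans (⌈n/2⌉≤n n) (n≤1+n n)))) sub

  μ-maximal : ∀ {i} → i ≤ ⌈ n /2⌉ → EndBlocks U i → i ≤ μ U
  μ-maximal i≤ blocks = foldr-⊔-≥ (∈-select⁺ (WniSub U) (∈-upTo⁺ (s≤s i≤))
    (Equivalence.from (WniSub⇔ (≤-trans i≤ (≤-trans (⌈n/2⌉≤n n) (n≤1+n n)))) blocks))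

-- Peripheral intervals

-- The weight profile of J_{n,s−1,e}.
PeripheralProfile : ℕ → (ℕ → Bool) → Set
PeripheralProfile n H = ∃ λ s → ∃ λ e → s ≤ n × 1 ≤ e × s ≤ e × e ≤ suc n ×
  Constant H true 0 s × Constant H false s e × Constant H true e (suc n)

module _ {n} (U : BSet n) (inv : WeightInvariant U) where

  IsPeripheralInterval⇔ : IsPeripheralInterval U ⇔ PeripheralProfile n (inW U)
  IsPeripheralInterval⇔ = mk⇔ to from
    where
    profile : ∀ {a e} s → s ≤ n → s ≤ e → 1 ≤ e → e ≤ suc n →
              (∀ w → (ℤ.+ w ℤ.≤ a) ⇔ (w < s)) →
              (∀ x → (U x ≡ true) ⇔ ((ℤ.+ weight x ℤ.≤ a) ⊎ (e ≤ weight x))) →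
              PeripheralProfile n (inW U)
    profile {a} {e} s s≤n s≤e 1≤e e≤1+n below⇔ U⇔ =
      s , e , s≤n , 1≤e , s≤e , e≤1+n ,
      (λ w _ w<s → Equivalence.from (member (≤-trans (<⇒≤ w<s) s≤n)) (inj₁ (Equivalence.from (below⇔ w) w<s))) ,
      (λ w s≤w w<e → ¬-not λ Uw → [ (λ w≤a → <⇒≱ (Equivalence.to (below⇔ w) w≤a) s≤w) , <⇒≱ w<e ]
                                    (Equivalence.to (member (≤-pred (≤-trans w<e e≤1+n))) Uw)) ,
      (λ w e≤w w<1+n → Equivalence.from (member (≤-pred w<1+n)) (inj₂ e≤w))
      where
      member : ∀ {w} → w ≤ n → (inW U w ≡ true) ⇔ ((ℤ.+ w ℤ.≤ a) ⊎ (e ≤ w))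
      member {w} w≤n = subst (λ v → (inW U w ≡ true) ⇔ ((ℤ.+ v ℤ.≤ a) ⊎ (e ≤ v))) (weight-prefix w≤n)
        (mk⇔ (Equivalence.to (U⇔ (prefix n w)) ∘ trans (sym (inW-prefix U inv w≤n)))
             (trans (inW-prefix U inv w≤n) ∘ Equivalence.from (U⇔ (prefix n w))))
    to : IsPeripheralInterval U → PeripheralProfile n (inW U)
    to (-[1+ 0 ] , e , _ , _ , 1≤e , e≤1+n , _ , U⇔) =
      profile 0 z≤n z≤n 1≤e e≤1+n (λ _ → mk⇔ (λ ()) (λ ())) U⇔
    to (ℤ.+ k , e , _ , k≤n-1 , 1≤e , e≤1+n , k<e , U⇔) =
      profile (suc k) (ℤ.drop‿+<+ (ℤ.i≤pred[j]⇒i<j {j = ℤ.+ n} k≤n-1)) (ℤ.drop‿+<+ k<e) 1≤e e≤1+n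
              (λ _ → mk⇔ (λ { (ℤ.+≤+ w≤k) → s≤s w≤k }) (λ { (s≤s w≤k) → ℤ.+≤+ w≤k })) U⇔
    to (-[1+ suc _ ] , _ , ℤ.-≤- () , _)
    from : PeripheralProfile n (inW U) → IsPeripheralInterval U
    from (s , e , s≤n , 1≤e , s≤e , e≤1+n , below , middle , above) =
      ℤ.pred (ℤ.+ s) , e , ℤ.pred-mono (ℤ.+≤+ {n = s} z≤n) , ℤ.pred-mono (ℤ.+≤+ s≤n) , 1≤e , e≤1+n ,
      ℤ.i≤pred[j]⇒i<j (ℤ.pred-mono (ℤ.+≤+ s≤e)) , λ x → mk⇔ (classify x) (member x)
      where
      member : ∀ x → (ℤ.+ weight x ℤ.≤ ℤ.pred (ℤ.+ s)) ⊎ (e ≤ weight x) → U x ≡ true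
      member x (inj₁ w≤s-1) = trans (inW-weight U inv x) (below _ z≤n (ℤ.drop‿+<+ (ℤ.i≤pred[j]⇒i<j w≤s-1)))
      member x (inj₂ e≤w)   = trans (inW-weight U inv x) (above _ e≤w (s≤s (weight≤n x)))
      classify : ∀ x → U x ≡ true → (ℤ.+ weight x ℤ.≤ ℤ.pred (ℤ.+ s)) ⊎ (e ≤ weight x)
      classify x Ux with weight x <? s | weight x <? e
      ... | yes w<s | _      = inj₁ (ℤ.i<j⇒i≤pred[j] (ℤ.+<+ w<s))
      ... | no  w≮s | yes w<e = contradiction (trans (sym (inW-weight U inv x)) Ux)
                                  (λ U|x| → contradiction (trans (sym U|x|) (middle _ (≮⇒≥ w≮s) w<e)) λ ())
      ... | no  _   | no  w≮e = inj₂ (≮⇒≥ w≮e)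

-- Comparing Λ̄_n(S) with n − r_n(S)

i+i≤n⇒i≤⌈n/2⌉ : ∀ {i n} → i + i ≤ n → i ≤ ⌈ n /2⌉
i+i≤n⇒i≤⌈n/2⌉ {i} {n} i+i≤n = ≮⇒≥ λ ⌈n/2⌉<i →
  <⇒≱ (subst (_< i + i) (⌊n/2⌋+⌈n/2⌉≡n n) (+-mono-< (≤-<-trans (⌊n/2⌋≤⌈n/2⌉ n) ⌈n/2⌉<i) ⌈n/2⌉<i))
      i+i≤n

module _ {n} (S : BSet n) (sym-S : Symmetric S) {p} (p≤n : p ≤ n) (Fp : inW S p ≡ true) where

  private
    inv = Symmetric⇒WeightInvariant S sym-S
    F = inW S
    G = inW (compl S)
    L = n ∸ r S
    M = μ (compl S)

    G≡not-F : ∀ {w} → w ≤ n → G w ≡ not (F w)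
    G≡not-F = inW-compl S inv

    F→G : ∀ {b lo hi} → hi ≤ suc n → Constant F b lo hi → Constant G (not b) lo hi
    F→G hi≤1+n c w lo≤w w<hi = trans (G≡not-F (≤-pred (≤-trans w<hi hi≤1+n))) (cong not (c w lo≤w w<hi))

    G→F : ∀ {b lo hi} → hi ≤ suc n → Constant G b lo hi → Constant F (not b) lo hi
    G→F hi≤1+n c w lo≤w w<hi =
      trans (sym (not-involutive (F w)))
            (cong not (trans (sym (G≡not-F (≤-pred (≤-trans w<hi hi≤1+n)))) (c w lo≤w w<hi)))

    M-blocks : EndBlocks (compl S) M
    M-blocks = μ-EndBlocks (compl S)

    M≤ : ∀ {w} → w ≤ n → F w ≡ true → M ≤ w × M ≤ n ∸ w
    M≤ {w} w≤n Fw = ≮⇒≥ (λ w<M → G-false (proj₁ M-blocks w z≤n w<M))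
                  , ≮⇒≥ (λ n∸w<M → G-false (proj₂ M-blocks w
                      (≤-trans (∸-monoʳ-≤ (suc n) n∸w<M) (≤-reflexive (m∸[m∸n]≡n w≤n))) (s≤s w≤n)))
      where
      G-false : G w ≢ true
      G-false Gw = contradiction (trans (sym Gw) (trans (G≡not-F w≤n) (cong not Fw))) λ ()

    M≤n : M ≤ n
    M≤n = ≤-trans (proj₁ (M≤ p≤n Fp)) p≤n

    LowerBound : Set
    LowerBound = L + M ≤ cardW (compl S) ×
                 (cardW (compl S) ≡ L + M → PeripheralProfile n F ⊎ PeripheralProfile n G)

    gap-above : ∀ {s} → s + L ≤ suc n → Constant F false s (s + L) → p < s → LowerBound
    gap-above {s} s+L≤1+n gap p<s = bound , peripheral
      where
      M≤s = ≤-trans (proj₁ (M≤ p≤n Fp)) (<⇒≤ p<s)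
      0<s = ≤-<-trans z≤n p<s
      s≤1+n = ≤-trans (m≤m+n s L) s+L≤1+n
      runs = two-runs G {a = 0} {k = M} {c = s} {l = L} {N = suc n} M≤s s+L≤1+n (proj₁ M-blocks) (F→G s+L≤1+n gap)
      bound : L + M ≤ cardW (compl S)
      bound = subst₂ _≤_ (+-comm M L) (sym (cardW≡countIn (compl S))) (proj₁ runs)
      peripheral : cardW (compl S) ≡ L + M → PeripheralProfile n F ⊎ PeripheralProfile n G
      peripheral eq = classify (proj₂ runs (trans (sym (cardW≡countIn (compl S))) (trans eq (+-comm L M))))
                               (s + L ≟ suc n)
        where
        classify : Constant G false 0 0 × Constant G false M s × Constant G false (s + L) (suc n) →
                   Dec (s + L ≡ suc n) → PeripheralProfile n F ⊎ PeripheralProfile n G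
        classify (_ , between , _) (yes s+L≡1+n) =
          inj₂ (M , s , M≤n , 0<s , M≤s , s≤1+n ,
                proj₁ M-blocks , between , subst (Constant G true s) s+L≡1+n (F→G s+L≤1+n gap))
        classify (_ , between , above) (no s+L≢1+n) =
          inj₁ (s , s + L , ≤-trans (m≤m+n s L) s+L≤n , ≤-trans 0<s (m≤m+n s L) , m≤m+n s L , s+L≤1+n ,
                G→F s≤1+n (subst (λ m → Constant G false m s) M≡0 between) , gap , G→F ≤-refl above)
          where
          s+L≤n = ≤-pred (≤∧≢⇒< s+L≤1+n s+L≢1+n)
          M≡0 : M ≡ 0
          M≡0 = n≤0⇒n≡0 (subst (M ≤_) (n∸n≡0 n)
                                (proj₂ (M≤ ≤-refl (G→F ≤-refl above n s+L≤n ≤-refl))))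

    gap-below : ∀ {s} → s + L ≤ suc n → Constant F false s (s + L) → s + L ≤ p → LowerBound
    gap-below {s} s+L≤1+n gap s+L≤p = bound , peripheral
      where
      u = suc n ∸ M
      p≤n∸M : p ≤ n ∸ M
      p≤n∸M = m+n≤o⇒m≤o∸n p (≤-trans (+-monoʳ-≤ p (proj₂ (M≤ p≤n Fp))) (≤-reflexive (m+[n∸m]≡n p≤n)))
      s+L≤u : s + L ≤ u
      s+L≤u = ≤-trans s+L≤p (≤-trans p≤n∸M (∸-monoˡ-≤ M (n≤1+n n)))
      u+M≡1+n : u + M ≡ suc n
      u+M≡1+n = m∸n+n≡m (m≤n⇒m≤1+n M≤n)
      runs = two-runs G {a = s} {k = L} {c = u} {l = M} {N = suc n} s+L≤u (≤-reflexive u+M≡1+n)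
               (F→G s+L≤1+n gap) (subst (Constant G true u) (sym u+M≡1+n) (proj₂ M-blocks))
      bound : L + M ≤ cardW (compl S)
      bound = subst (L + M ≤_) (sym (cardW≡countIn (compl S))) (proj₁ runs)
      peripheral : cardW (compl S) ≡ L + M → PeripheralProfile n F ⊎ PeripheralProfile n G
      peripheral eq = classify (proj₂ runs (trans (sym (cardW≡countIn (compl S))) eq)) (s ≟ 0)
        where
        classify : Constant G false 0 s × Constant G false (s + L) u × Constant G false (u + M) (suc n) →
                   Dec (s ≡ 0) → PeripheralProfile n F ⊎ PeripheralProfile n G
        classify (_ , between , _) (yes s≡0) =
          inj₂ (L , u , ≤-trans (m≤n+m L s) (≤-trans s+L≤p p≤n) , m<n⇒0<n∸m (s≤s M≤n) ,
                ≤-trans (m≤n+m L s) s+L≤u , m∸n≤m (suc n) M ,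
                subst (λ s → Constant G true s (s + L)) s≡0 (F→G s+L≤1+n gap) ,
                subst (λ s → Constant G false (s + L) u) s≡0 between , proj₂ M-blocks)
        classify (below , between , _) (no s≢0) =
          inj₁ (s , s + L , ≤-trans (m≤m+n s L) (≤-trans s+L≤p p≤n) , ≤-trans 0<s (m≤m+n s L) ,
                m≤m+n s L , s+L≤1+n ,
                G→F s≤1+n below , gap , G→F ≤-refl (subst (Constant G false (s + L)) u≡1+n between))
          where
          0<s = n≢0⇒n>0 s≢0
          s≤1+n = ≤-trans (m≤m+n s L) s+L≤1+n
          u≡1+n : u ≡ suc n
          u≡1+n = cong (suc n ∸_) (n≤0⇒n≡0 (proj₁ (M≤ z≤n (G→F s≤1+n below 0 z≤n 0<s))))

  cardW-lower-bound : n ∸ r S + μ (compl S) ≤ cardW (compl S) ×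
                      (cardW (compl S) ≡ n ∸ r S + μ (compl S) →
                       PeripheralProfile n (inW S) ⊎ PeripheralProfile n (inW (compl S)))
  cardW-lower-bound with gap-of-length-n∸r S inv
  ... | s , s+L≤1+n , gap with p <? s
  ...   | yes p<s = gap-above s+L≤1+n gap p<s
  ...   | no  p≮s = gap-below s+L≤1+n gap
                      (≮⇒≥ λ p<s+L → contradiction (trans (sym Fp) (gap p (≮⇒≥ p≮s) p<s+L)) λ ())

  cardW-upper-bound : PeripheralProfile n (inW S) ⊎ PeripheralProfile n (inW (compl S)) →
                      cardW (compl S) ≤ n ∸ r S + μ (compl S)
  cardW-upper-bound (inj₁ (s , e , s≤n , _ , s≤e , e≤1+n , below , middle , above)) =
    subst (_≤ L + M) (sym (cardW≡countIn (compl S)))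
      (≤-trans (countIn-≤-support G s≤e e≤1+n (F→G (≤-trans s≤e e≤1+n) below) (F→G ≤-refl above))
               (≤-trans (gap-length s≤e e≤1+n below middle above) (m≤m+n L M)))
    where
    gap-length : ∀ {s e} → s ≤ e → e ≤ suc n → Constant F true 0 s → Constant F false s e →
                 Constant F true e (suc n) → e ∸ s ≤ L
    gap-length {zero} {e} _ _ _ middle above = gap-before-≤ S inv (above e ≤-refl (s≤s e≤n)) e≤n middle
      where
      e≤n = ≤-trans (≮⇒≥ λ p<e → contradiction (trans (sym Fp) (middle p z≤n p<e)) λ ()) p≤n
    gap-length {suc s} {e} 1+s≤e e≤1+n below middle _ =
      gap-after-≤ S inv (below s z≤n ≤-refl) (≤-pred (subst (_≤ suc n) (sym e≡) e≤1+n))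
                  (subst (Constant F false (suc s)) (sym e≡) middle)
      where
      e≡ : suc (s + (e ∸ suc s)) ≡ e
      e≡ = m+[n∸m]≡n 1+s≤e
  cardW-upper-bound (inj₂ (s , suc e , s≤n , _ , s≤1+e , 1+e≤1+n , below , middle , above)) =
    subst (_≤ L + M) (sym (cardW≡countIn (compl S)))
      (≤-trans (countIn-≤-hole G s≤1+e 1+e≤1+n middle) s+d≤L+M)
    where
    d = n ∸ e
    Gp≢true : G p ≢ true
    Gp≢true Gp = contradiction (trans (sym Gp) (trans (G≡not-F p≤n) (cong not Fp))) λ ()
    s≤p : s ≤ p
    s≤p = ≮⇒≥ λ p<s → Gp≢true (below p z≤n p<s)
    p≤e : p ≤ e
    p≤e = ≤-pred (≰⇒> λ 1+e≤p → Gp≢true (above p 1+e≤p (s≤s p≤n)))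
    e≤n = ≤-pred 1+e≤1+n
    F-middle = G→F 1+e≤1+n middle
    s≤L : s ≤ L
    s≤L = gap-before-≤ S inv (F-middle s ≤-refl (s≤s (≤-trans s≤p p≤e))) s≤n
                       (G→F (≤-trans s≤1+e 1+e≤1+n) below)
    d≤L : d ≤ L
    d≤L = gap-after-≤ S inv (F-middle e (≤-trans s≤p p≤e) ≤-refl) (≤-reflexive (m+[n∸m]≡n e≤n))
            (subst (Constant F false (suc e)) (cong suc (sym (m+[n∸m]≡n e≤n))) (G→F ≤-refl above))
    s+d≤n : s + d ≤ n
    s+d≤n = ≤-trans (+-monoˡ-≤ d (≤-trans s≤p p≤e)) (≤-reflexive (m+[n∸m]≡n e≤n))
    suffix : Constant G true (suc n ∸ d) (suc n)
    suffix = subst (λ x → Constant G true x (suc n)) (sym (m∸[m∸n]≡n 1+e≤1+n)) above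
    -- The shorter end block fits in the μ-blocks; the longer is a gap next to a weight of S.
    s+d≤L+M : s + d ≤ L + M
    s+d≤L+M with ≤-total s d
    ... | inj₁ s≤d = subst (s + d ≤_) (+-comm M L) (+-mono-≤ s≤M d≤L)
      where
      s≤M = μ-maximal (compl S) (i+i≤n⇒i≤⌈n/2⌉ (≤-trans (+-monoʳ-≤ s s≤d) s+d≤n))
              (below , Constant-⊆ (∸-monoʳ-≤ (suc n) s≤d) ≤-refl suffix)
    ... | inj₂ d≤s = +-mono-≤ s≤L d≤M
      where
      d≤M = μ-maximal (compl S) (i+i≤n⇒i≤⌈n/2⌉ (≤-trans (+-monoˡ-≤ d d≤s) s+d≤n))
              (Constant-⊆ ≤-refl d≤s below , suffix)

corollary1p19 : (n : ℕ) (S : BSet n) → Nonempty S → Symmetric S →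
                  (n ∸ r S ≤ Λbar S) ×
                  ((Λbar S ≡ n ∸ r S) ⇔ (IsPeripheralInterval S ⊎ IsPeripheralInterval (compl S)))
corollary1p19 n S (x , Sx) sym-S = n∸r≤Λbar , mk⇔ equality⇒peripheral peripheral⇒equality
  where
  inv = Symmetric⇒WeightInvariant S sym-S
  F|x| = trans (sym (inW-weight S inv x)) Sx
  lower = cardW-lower-bound S sym-S (weight≤n x) F|x|
  n∸r≤Λbar : n ∸ r S ≤ Λbar S
  n∸r≤Λbar = m+n≤o⇒m≤o∸n (n ∸ r S) (proj₁ lower)
  profiles = IsPeripheralInterval⇔ S inv ⊎-⇔ IsPeripheralInterval⇔ (compl S) (WeightInvariant-compl S inv)
  equality⇒peripheral : Λbar S ≡ n ∸ r S → IsPeripheralInterval S ⊎ IsPeripheralInterval (compl S)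
  equality⇒peripheral eq = Equivalence.from profiles (proj₂ lower
    (trans (sym (m∸n+n≡m (≤-trans (m≤n+m _ (n ∸ r S)) (proj₁ lower)))) (cong (_+ μ (compl S)) eq)))
  peripheral⇒equality : IsPeripheralInterval S ⊎ IsPeripheralInterval (compl S) → Λbar S ≡ n ∸ r S
  peripheral⇒equality per = ≤-antisym
    (m≤n+o⇒m∸n≤o _ (μ (compl S)) (subst (cardW (compl S) ≤_) (+-comm (n ∸ r S) _)
      (cardW-upper-bound S sym-S (weight≤n x) F|x| (Equivalence.to profiles per))))
    n∸r≤Λbar
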